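{- For every odd $n \ge 3$, the group $D_{2n} \times D_{2n}$ is non-CCA; that is, there exists a connected Cayley graph of $D_{2n}\times D_{2n}$ that admits a colour-preserving automorphism which is not affine.
   Context: For a group $G$ and $C \subseteq G\setminus\{e\}$, the Cayley graph $\mathrm{Cay}(G,C)$ has vertex set $G$ and an edge between $g$ and $gc$ for each $g\in G$, $c \in C$; the edge $\{g,gc\}$ is coloured $\{c,c^{ -1}\}$. A colour-preserving automorphism is a graph automorphism mapping each edge to an edge of the same colour. A permutation of $G$ is affine if it has the form $g\mapsto h\alpha(g)$ with $h\in G$ and $\alpha\in\mathrm{Aut}(G)$. A Cayley graph is CCA if all its colour-preserving automorphisms are affine; a group $G$ is CCA if every connected Cayley graph of $G$ is CCA, and non-CCA otherwise. $D_{2n}$ is the dihedral group of order $2n$. -}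

module Defs where

open import Data.Bool using (Bool; true; false; _xor_)
open import Data.Nat using (ℕ; zero; suc; _+_; _*_; _∸_; _%_; NonZero)
open import Data.Nat.DivMod using (m%n<n)
open import Data.Fin using (Fin; toℕ; fromℕ<)
open import Data.Product using (Σ; ∃; _×_; _,_)
open import Data.Sum using (_⊎_)
open import Data.List using (List)
open import Data.List.Membership.Propositional using (_∈_; _∉_)
open import Relation.Binary.PropositionalEquality using (_≡_)
open import Relation.Binary.Construct.Closure.ReflexiveTransitive using (Star)
open import Relation.Nullary using (¬_)
open import Function.Definitions using (Bijective)

record GroupOps : Set₁ where
  infixl 7 _∙_
  infix 8 _⁻¹
  field
    Carrier : Set
    _∙_     : Carrier → Carrier → Carrier
    e       : Carrier
    _⁻¹     : Carrier → Carrier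

module CayleyNotions (G : GroupOps) where
  open GroupOps G

  Adj : List Carrier → Carrier → Carrier → Set
  Adj C g h = Σ Carrier λ c → c ∈ C × (h ≡ g ∙ c ⊎ g ≡ h ∙ c)

  Connected : List Carrier → Set
  Connected C = ∀ g h → Star (Adj C) g h

  IsGraphAut : List Carrier → (Carrier → Carrier) → Set
  IsGraphAut C φ = Bijective _≡_ _≡_ φ
    × (∀ g h → (Adj C g h → Adj C (φ g) (φ h)) × (Adj C (φ g) (φ h) → Adj C g h))

  -- Colour-preserving: the edge {g, g c} (colour {c, c⁻¹}) is mapped to
  -- the edge {φ g, φ (g c)}, whose colour is {d, d⁻¹} with d = (φ g)⁻¹ φ (g c);
  -- these colours coincide iff d = c or d = c⁻¹.
  IsColourPreservingAut : List Carrier → (Carrier → Carrier) → Set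
  IsColourPreservingAut C φ = IsGraphAut C φ
    × (∀ g c → c ∈ C → ((φ g) ⁻¹ ∙ φ (g ∙ c) ≡ c ⊎ (φ g) ⁻¹ ∙ φ (g ∙ c) ≡ c ⁻¹))

  IsAutomorphism : (Carrier → Carrier) → Set
  IsAutomorphism α = Bijective _≡_ _≡_ α × (∀ x y → α (x ∙ y) ≡ α x ∙ α y)

  IsAffine : (Carrier → Carrier) → Set
  IsAffine φ = Σ Carrier λ h → Σ (Carrier → Carrier) λ α →
    IsAutomorphism α × (∀ g → φ g ≡ h ∙ α g)

  NonCCA : Set
  NonCCA = Σ (List Carrier) λ C → e ∉ C × Connected C ×
    Σ (Carrier → Carrier) λ φ → IsColourPreservingAut C φ × ¬ IsAffine φ

_×G_ : GroupOps → GroupOps → GroupOps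
G ×G H = record
  { Carrier = G.Carrier × H.Carrier
  ; _∙_ = λ { (a , b) (c , d) → (a G.∙ c) , (b H.∙ d) }
  ; e = G.e , H.e
  ; _⁻¹ = λ { (a , b) → (a G.⁻¹) , (b H.⁻¹) }
  }
  where module G = GroupOps G
        module H = GroupOps H

-- Dihedral group D_{2n} of order 2n: (false , k) is r^k, (true , k) is r^k s,
-- with s r s = r⁻¹.

module _ (n : ℕ) .{{_ : NonZero n}} where
  modN : ℕ → Fin n
  modN m = fromℕ< (m%n<n m n)

  addN : Fin n → Fin n → Fin n
  addN i j = modN (toℕ i + toℕ j)

  negN : Fin n → Fin n
  negN i = modN (n ∸ toℕ i)

  D-mul : Bool × Fin n → Bool × Fin n → Bool × Fin n
  D-mul (false , i) (t , j) = t , addN i j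
  D-mul (true  , i) (t , j) = (true xor t) , addN i (negN j)

  D-inv : Bool × Fin n → Bool × Fin n
  D-inv (false , i) = false , negN i
  D-inv (true  , i) = true , i

  Dihedral : GroupOps
  Dihedral = record
    { Carrier = Bool × Fin n
    ; _∙_ = D-mul
    ; e = false , modN 0
    ; _⁻¹ = D-inv
    }

-- The connection set is C = {(1, s), (r, r), (s, 1)} and φ exchanges the rotation parts,
-- (rⁱ sᵃ, rʲ sᵇ) ↦ (rʲ sᵃ, rⁱ sᵇ). It is an involution sending each edge {g, g c} to
-- {φ g, φ g c} or {φ g, φ g c⁻¹}: for the two reflection generators φ commutes with
-- right multiplication, and for (r, r) the rotation part of a reflection coordinate moves
-- backwards, so the two coordinates either both see r or both see r⁻¹. An affine map fixing
-- the identity is an automorphism, but φ is not a homomorphism since r⁻¹ ≠ r for n ≥ 3.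
-- Connectedness uses that n is odd: reflecting one coordinate turns the generator (r, r)
-- into a move that changes the difference of the rotation parts by 2, which generates ℤ/n.
module Submission where

open import Defs
open import Data.Nat using (ℕ; suc; _*_; _≤_; NonZero)
open import Data.Product using (∃)
open import Relation.Binary.PropositionalEquality using (_≡_)

open import Algebra.Bundles using (Group; AbelianGroup)
open import Algebra.Core using (Op₁; Op₂)
open import Algebra.Definitions using (Associative; Identity; Inverse)
open import Algebra.Structures using (IsGroup)
import Algebra.Properties.AbelianGroup as AbelianGroupProperties
import Algebra.Properties.Group as GroupProperties
open import Data.Bool using (Bool; true; false; not)
open import Data.Bool.Properties using (not-involutive)
open import Data.Fin using (Fin; toℕ)
open import Data.Fin.Properties using (toℕ-injective; toℕ-fromℕ<; toℕ<n)
open import Data.List using (List; _∷_; [])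
open import Data.List.Membership.Propositional using (_∈_; _∉_)
open import Data.List.Relation.Unary.Any using (here; there)
open import Data.Nat using (zero; _+_; _∸_; _%_; _<_; z<s)
open import Data.Nat.DivMod using (m%n<n; m<n⇒m%n≡m; [m+n]%n≡m%n; [m+kn]%n≡m%n; %-distribˡ-+)
import Data.Nat.Properties as ℕ
open import Data.Nat.Tactic.RingSolver using (solve-∀)
open import Data.Product using (_×_; _,_; proj₁; proj₂)
open import Data.Sum using (_⊎_; inj₁; inj₂)
open import Function using (_∘_; id)
open import Function.Consequences.Propositional
  using (inverseᵇ⇒bijective; strictlyInverseˡ⇒inverseˡ; strictlyInverseʳ⇒inverseʳ)
open import Function.Definitions using (Bijective)
open import Level using (0ℓ)
open import Relation.Binary.Construct.Closure.ReflexiveTransitive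
  using (Star; ε; _◅_; _◅◅_; reverse)
open import Relation.Binary.PropositionalEquality
  using (refl; sym; trans; cong; cong₂; subst; subst₂; isEquivalence; module ≡-Reasoning)
open import Relation.Nullary using (¬_)

isGroup-≡ : {A : Set} {_∙_ : Op₂ A} {ε : A} {_⁻¹ : Op₁ A} →
  Associative _≡_ _∙_ → Identity _≡_ ε _∙_ → Inverse _≡_ ε _⁻¹ _∙_ →
  IsGroup _≡_ _∙_ ε _⁻¹
isGroup-≡ {_∙_ = _∙_} {_⁻¹ = _⁻¹} assoc identity inverse = record
  { isMonoid = record
    { isSemigroup = record
      { isMagma = record { isEquivalence = isEquivalence ; ∙-cong = cong₂ _∙_ }
      ; assoc = assoc
      }
    ; identity = identity
    }
  ; inverse = inverse
  ; ⁻¹-cong = cong _⁻¹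
  }

IsGroupOps : GroupOps → Set
IsGroupOps G = IsGroup _≡_ _∙_ e _⁻¹
  where open GroupOps G

×G-isGroupOps : ∀ {G H} → IsGroupOps G → IsGroupOps H → IsGroupOps (G ×G H)
×G-isGroupOps G-isGroup H-isGroup = isGroup-≡
  (λ _ _ _ → cong₂ _,_ (G.assoc _ _ _) (H.assoc _ _ _))
  ( (λ _ → cong₂ _,_ (G.identityˡ _) (H.identityˡ _))
  , (λ _ → cong₂ _,_ (G.identityʳ _) (H.identityʳ _)))
  ( (λ _ → cong₂ _,_ (G.inverseˡ _) (H.inverseˡ _))
  , (λ _ → cong₂ _,_ (G.inverseʳ _) (H.inverseʳ _)))
  where
    module G = IsGroup G-isGroup
    module H = IsGroup H-isGroup

module CayleyGraphs (G : GroupOps) (isGroup : IsGroupOps G) where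
  open GroupOps G
  open CayleyNotions G
  open IsGroup isGroup using (identityˡ; identityʳ)

  group : Group 0ℓ 0ℓ
  group = record { isGroup = isGroup }

  open GroupProperties group
    using (identityˡ-unique; \\-leftDividesʳ; //-rightDividesˡ)

  Adj-sym : ∀ {C g h} → Adj C g h → Adj C h g
  Adj-sym (c , c∈C , inj₁ h≡gc) = c , c∈C , inj₂ h≡gc
  Adj-sym (c , c∈C , inj₂ g≡hc) = c , c∈C , inj₁ g≡hc

  ◅-∙ : ∀ {C g x c} → c ∈ C → Star (Adj C) g x → Star (Adj C) (g ∙ c) x
  ◅-∙ c∈C walk = (_ , c∈C , inj₂ refl) ◅ walk

  reach-e⇒connected : ∀ {C} → (∀ g → Star (Adj C) g e) → Connected C
  reach-e⇒connected reach g h = reach g ◅◅ reverse Adj-sym (reach h)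

  involution⇒isColourPreservingAut : ∀ {C φ} → (∀ g → φ (φ g) ≡ g) →
    (∀ g c → c ∈ C → φ (g ∙ c) ≡ φ g ∙ c ⊎ φ (g ∙ c) ≡ φ g ∙ c ⁻¹) →
    IsColourPreservingAut C φ
  involution⇒isColourPreservingAut {C} {φ} involutive edge =
    (bijective , λ g h → preserves g h , reflects g h) , colour
    where
      bijective : Bijective _≡_ _≡_ φ
      bijective = inverseᵇ⇒bijective
        (strictlyInverseˡ⇒inverseˡ φ involutive , strictlyInverseʳ⇒inverseʳ φ involutive)

      edge-adj : ∀ g c → c ∈ C → Adj C (φ g) (φ (g ∙ c))
      edge-adj g c c∈C with edge g c c∈C
      ... | inj₁ same     = c , c∈C , inj₁ same
      ... | inj₂ inverted =
        c , c∈C , inj₂ (trans (sym (//-rightDividesˡ c (φ g))) (cong (_∙ c) (sym inverted)))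

      preserves : ∀ g h → Adj C g h → Adj C (φ g) (φ h)
      preserves g h (c , c∈C , inj₁ refl) = edge-adj g c c∈C
      preserves g h (c , c∈C , inj₂ refl) = Adj-sym (edge-adj h c c∈C)

      reflects : ∀ g h → Adj C (φ g) (φ h) → Adj C g h
      reflects g h = subst₂ (Adj C) (involutive g) (involutive h) ∘ preserves (φ g) (φ h)

      colour : ∀ g c → c ∈ C → (φ g) ⁻¹ ∙ φ (g ∙ c) ≡ c ⊎ (φ g) ⁻¹ ∙ φ (g ∙ c) ≡ c ⁻¹
      colour g c c∈C with edge g c c∈C
      ... | inj₁ same     = inj₁ (trans (cong ((φ g) ⁻¹ ∙_) same) (\\-leftDividesʳ (φ g) c))
      ... | inj₂ inverted = inj₂ (trans (cong ((φ g) ⁻¹ ∙_) inverted) (\\-leftDividesʳ (φ g) (c ⁻¹)))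

  affine∧fixes-e⇒homomorphism : ∀ {φ} → IsAffine φ → φ e ≡ e →
    ∀ x y → φ (x ∙ y) ≡ φ x ∙ φ y
  affine∧fixes-e⇒homomorphism {φ} (h , α , (_ , α-hom) , φ≡hα) φe≡e x y = begin
    φ (x ∙ y)  ≡⟨ φ≗α (x ∙ y) ⟩
    α (x ∙ y)  ≡⟨ α-hom x y ⟩
    α x ∙ α y  ≡⟨ cong₂ _∙_ (φ≗α x) (φ≗α y) ⟨
    φ x ∙ φ y  ∎
    where
      open ≡-Reasoning
      αe≡e : α e ≡ e
      αe≡e = identityˡ-unique (α e) (α e) (trans (sym (α-hom e e)) (cong α (identityˡ e)))

      h≡e : h ≡ e
      h≡e = begin
        h        ≡⟨ identityʳ h ⟨
        h ∙ e    ≡⟨ cong (h ∙_) αe≡e ⟨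
        h ∙ α e  ≡⟨ φ≡hα e ⟨
        φ e      ≡⟨ φe≡e ⟩
        e        ∎

      φ≗α : ∀ g → φ g ≡ α g
      φ≗α g = trans (φ≡hα g) (trans (cong (_∙ α g) h≡e) (identityˡ (α g)))

module ℤ/n (n : ℕ) .{{_ : NonZero n}} where

  infixl 6 _⊕_
  infix 8 ⊖_

  _⊕_ : Fin n → Fin n → Fin n
  _⊕_ = addN n

  ⊖_ : Fin n → Fin n
  ⊖_ = negN n

  [_] : ℕ → Fin n
  [_] = modN n

  toℕ-modN : ∀ m → toℕ [ m ] ≡ m % n
  toℕ-modN m = toℕ-fromℕ< (m%n<n m n)

  modN-toℕ : ∀ i → [ toℕ i ] ≡ i
  modN-toℕ i = toℕ-injective (trans (toℕ-modN (toℕ i)) (m<n⇒m%n≡m (toℕ<n i)))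

  modN-cong : ∀ {a b} → a % n ≡ b % n → [ a ] ≡ [ b ]
  modN-cong {a} {b} a≡b = toℕ-injective (trans (toℕ-modN a) (trans a≡b (sym (toℕ-modN b))))

  modN-injective-< : ∀ {a b} → a < n → b < n → [ a ] ≡ [ b ] → a ≡ b
  modN-injective-< {a} {b} a<n b<n eq = begin
    a            ≡⟨ m<n⇒m%n≡m a<n ⟨
    a % n        ≡⟨ toℕ-modN a ⟨
    toℕ [ a ]    ≡⟨ cong toℕ eq ⟩
    toℕ [ b ]    ≡⟨ toℕ-modN b ⟩
    b % n        ≡⟨ m<n⇒m%n≡m b<n ⟩
    b            ∎
    where open ≡-Reasoning

  modN-+ : ∀ a b → [ a + b ] ≡ [ a ] ⊕ [ b ]
  modN-+ a b = toℕ-injective (begin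
    toℕ [ a + b ]                   ≡⟨ toℕ-modN (a + b) ⟩
    (a + b) % n                     ≡⟨ %-distribˡ-+ a b n ⟩
    (a % n + b % n) % n             ≡⟨ cong₂ (λ u v → (u + v) % n) (toℕ-modN a) (toℕ-modN b) ⟨
    (toℕ [ a ] + toℕ [ b ]) % n     ≡⟨ toℕ-modN _ ⟨
    toℕ ([ a ] ⊕ [ b ])             ∎)
    where open ≡-Reasoning

  -- The group laws are pulled back along the surjective homomorphism [_] : (ℕ, +) → ℤ/n.
  ⊕-assoc : ∀ x y z → (x ⊕ y) ⊕ z ≡ x ⊕ (y ⊕ z)
  ⊕-assoc x y z = begin
    (x ⊕ y) ⊕ z                     ≡⟨ cong ((x ⊕ y) ⊕_) (modN-toℕ z) ⟨
    [ toℕ x + toℕ y ] ⊕ [ toℕ z ]   ≡⟨ modN-+ (toℕ x + toℕ y) (toℕ z) ⟨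
    [ toℕ x + toℕ y + toℕ z ]       ≡⟨ cong [_] (ℕ.+-assoc (toℕ x) (toℕ y) (toℕ z)) ⟩
    [ toℕ x + (toℕ y + toℕ z) ]     ≡⟨ modN-+ (toℕ x) (toℕ y + toℕ z) ⟩
    [ toℕ x ] ⊕ (y ⊕ z)             ≡⟨ cong (_⊕ (y ⊕ z)) (modN-toℕ x) ⟩
    x ⊕ (y ⊕ z)                     ∎
    where open ≡-Reasoning

  ⊕-comm : ∀ x y → x ⊕ y ≡ y ⊕ x
  ⊕-comm x y = cong [_] (ℕ.+-comm (toℕ x) (toℕ y))

  ⊕-identityʳ : ∀ x → x ⊕ [ 0 ] ≡ x
  ⊕-identityʳ x = begin
    x ⊕ [ 0 ]            ≡⟨ cong (_⊕ [ 0 ]) (modN-toℕ x) ⟨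
    [ toℕ x ] ⊕ [ 0 ]    ≡⟨ modN-+ (toℕ x) 0 ⟨
    [ toℕ x + 0 ]        ≡⟨ cong [_] (ℕ.+-identityʳ (toℕ x)) ⟩
    [ toℕ x ]            ≡⟨ modN-toℕ x ⟩
    x                    ∎
    where open ≡-Reasoning

  ⊕-inverseʳ : ∀ x → x ⊕ ⊖ x ≡ [ 0 ]
  ⊕-inverseʳ x = begin
    x ⊕ ⊖ x                       ≡⟨ cong (_⊕ ⊖ x) (modN-toℕ x) ⟨
    [ toℕ x ] ⊕ [ n ∸ toℕ x ]     ≡⟨ modN-+ (toℕ x) (n ∸ toℕ x) ⟨
    [ toℕ x + (n ∸ toℕ x) ]       ≡⟨ cong [_] (ℕ.m+[n∸m]≡n (ℕ.<⇒≤ (toℕ<n x))) ⟩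
    [ n ]                         ≡⟨ modN-cong ([m+n]%n≡m%n 0 n) ⟩
    [ 0 ]                         ∎
    where open ≡-Reasoning

  ⊕-identityˡ : ∀ x → [ 0 ] ⊕ x ≡ x
  ⊕-identityˡ x = trans (⊕-comm [ 0 ] x) (⊕-identityʳ x)

  ⊕-inverseˡ : ∀ x → ⊖ x ⊕ x ≡ [ 0 ]
  ⊕-inverseˡ x = trans (⊕-comm (⊖ x) x) (⊕-inverseʳ x)

  ℤₙ : AbelianGroup 0ℓ 0ℓ
  ℤₙ = record
    { isAbelianGroup = record
      { isGroup = isGroup-≡ ⊕-assoc (⊕-identityˡ , ⊕-identityʳ) (⊕-inverseˡ , ⊕-inverseʳ)
      ; comm    = ⊕-comm
      }
    }

  modN-suc : ∀ m → [ suc m ] ≡ [ m ] ⊕ [ 1 ]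
  modN-suc m = trans (cong [_] (ℕ.+-comm 1 m)) (modN-+ m 1)

  [1]≢[0] : 2 ≤ n → ¬ [ 1 ] ≡ [ 0 ]
  [1]≢[0] 2≤n eq with modN-injective-< 2≤n (ℕ.<-≤-trans z<s 2≤n) eq
  ... | ()

  ⊖[1]≢[1] : 3 ≤ n → ¬ ⊖ [ 1 ] ≡ [ 1 ]
  ⊖[1]≢[1] 3≤n eq with modN-injective-< 3≤n (ℕ.<-≤-trans z<s 3≤n) [2]≡[0]
    where
      [2]≡[0] : [ 2 ] ≡ [ 0 ]
      [2]≡[0] = trans (modN-+ 1 1) (trans (cong ([ 1 ] ⊕_) (sym eq)) (⊕-inverseʳ [ 1 ]))
  ... | ()

  -- 2 (k + 1) = n + 1, so k + 1 is the inverse of 2 modulo n = 2k + 1.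
  modN-halve : ∀ k → n ≡ suc (2 * k) → ∀ d → [ (suc k * d) * 2 ] ≡ [ d ]
  modN-halve k n-odd d = modN-cong (begin
    ((suc k * d) * 2) % n        ≡⟨ cong (_% n) (doubling k d) ⟩
    (d + d * suc (2 * k)) % n    ≡⟨ cong (λ m → (d + d * m) % n) n-odd ⟨
    (d + d * n) % n              ≡⟨ [m+kn]%n≡m%n d d n ⟩
    d % n                        ∎)
    where
      open ≡-Reasoning
      doubling : ∀ k d → (suc k * d) * 2 ≡ d + d * suc (2 * k)
      doubling = solve-∀

module DihedralGroup (n : ℕ) .{{_ : NonZero n}} where
  open ℤ/n n
  open AbelianGroupProperties ℤₙ using (⁻¹-involutive; ⁻¹-∙-comm; ε⁻¹≈ε)
  open GroupOps (Dihedral n)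

  ∙-assoc : Associative _≡_ _∙_
  ∙-assoc (false , i) (false , j) (t , k) = cong (t ,_) (⊕-assoc i j k)
  ∙-assoc (false , i) (true  , j) (t , k) = cong (not t ,_) (⊕-assoc i j (⊖ k))
  ∙-assoc (true  , i) (false , j) (t , k) = cong (not t ,_) (begin
    i ⊕ ⊖ j ⊕ ⊖ k        ≡⟨ ⊕-assoc i (⊖ j) (⊖ k) ⟩
    i ⊕ (⊖ j ⊕ ⊖ k)      ≡⟨ cong (i ⊕_) (⁻¹-∙-comm j k) ⟩
    i ⊕ ⊖ (j ⊕ k)        ∎)
    where open ≡-Reasoning
  ∙-assoc (true  , i) (true  , j) (t , k) = cong₂ _,_ (sym (not-involutive t)) (begin
    i ⊕ ⊖ j ⊕ k          ≡⟨ ⊕-assoc i (⊖ j) k ⟩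
    i ⊕ (⊖ j ⊕ k)        ≡⟨ cong (λ u → i ⊕ (⊖ j ⊕ u)) (⁻¹-involutive k) ⟨
    i ⊕ (⊖ j ⊕ ⊖ ⊖ k)    ≡⟨ cong (i ⊕_) (⁻¹-∙-comm j (⊖ k)) ⟩
    i ⊕ ⊖ (j ⊕ ⊖ k)      ∎)
    where open ≡-Reasoning

  ∙-identity : Identity _≡_ e _∙_
  ∙-identity =
      (λ { (t , j) → cong (t ,_) (⊕-identityˡ j) })
    , (λ { (false , i) → cong (false ,_) (⊕-identityʳ i)
         ; (true  , i) → cong (true ,_) (trans (cong (i ⊕_) ε⁻¹≈ε) (⊕-identityʳ i)) })

  ∙-inverse : Inverse _≡_ e _⁻¹ _∙_
  ∙-inverse =
      (λ { (false , i) → cong (false ,_) (⊕-inverseˡ i)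
         ; (true  , i) → cong (false ,_) (⊕-inverseʳ i) })
    , (λ { (false , i) → cong (false ,_) (⊕-inverseʳ i)
         ; (true  , i) → cong (false ,_) (⊕-inverseʳ i) })

  dihedral-isGroupOps : IsGroupOps (Dihedral n)
  dihedral-isGroupOps = isGroup-≡ ∙-assoc ∙-identity ∙-inverse

  ∙-reflection : ∀ t i → (t , i) ∙ (true , [ 0 ]) ≡ (not t , i)
  ∙-reflection false i = cong (true ,_) (⊕-identityʳ i)
  ∙-reflection true  i = cong (false ,_) (trans (cong (i ⊕_) ε⁻¹≈ε) (⊕-identityʳ i))

module RotationSwap (n : ℕ) .{{_ : NonZero n}} where
  open ℤ/n n
  open AbelianGroupProperties ℤₙ using (⁻¹-involutive; //-rightDividesˡ; //-rightDividesʳ)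
  open DihedralGroup n using (dihedral-isGroupOps; ∙-reflection)
  module D = IsGroup dihedral-isGroupOps

  D×D : GroupOps
  D×D = Dihedral n ×G Dihedral n

  open GroupOps D×D
  open CayleyNotions D×D
  open CayleyGraphs D×D (×G-isGroupOps dihedral-isGroupOps dihedral-isGroupOps)

  1D s r : Bool × Fin n
  1D = false , [ 0 ]
  s  = true  , [ 0 ]
  r  = false , [ 1 ]

  connectionSet : List Carrier
  connectionSet = (1D , s) ∷ (r , r) ∷ (s , 1D) ∷ []

  swapRotations : Carrier → Carrier
  swapRotations ((t , i) , (u , j)) = (t , j) , (u , i)

  swapRotations-edge : ∀ g c → c ∈ connectionSet →
    swapRotations (g ∙ c) ≡ swapRotations g ∙ c ⊎ swapRotations (g ∙ c) ≡ swapRotations g ∙ c ⁻¹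
  swapRotations-edge ((t , i) , (u , j)) _ (here refl) = inj₁ (trans
    (cong swapRotations (cong₂ _,_ (D.identityʳ (t , i)) (∙-reflection u j)))
    (sym (cong₂ _,_ (D.identityʳ (t , j)) (∙-reflection u i))))
  swapRotations-edge ((t , i) , (u , j)) _ (there (there (here refl))) = inj₁ (trans
    (cong swapRotations (cong₂ _,_ (∙-reflection t i) (D.identityʳ (u , j))))
    (sym (cong₂ _,_ (∙-reflection t j) (D.identityʳ (u , i)))))
  swapRotations-edge ((false , i) , (false , j)) _ (there (here refl)) = inj₁ refl
  swapRotations-edge ((true  , i) , (true  , j)) _ (there (here refl)) = inj₁ refl
  swapRotations-edge ((false , i) , (true  , j)) _ (there (here refl)) =
    inj₂ (cong (λ v → (false , j ⊕ ⊖ [ 1 ]) , (true , i ⊕ v)) (sym (⁻¹-involutive [ 1 ])))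
  swapRotations-edge ((true  , i) , (false , j)) _ (there (here refl)) =
    inj₂ (cong (λ v → (true , j ⊕ v) , (false , i ⊕ ⊖ [ 1 ])) (sym (⁻¹-involutive [ 1 ])))
  swapRotations-edge _ _ (there (there (there ())))

  swapRotations-not-homomorphism : 3 ≤ n →
    ¬ (∀ x y → swapRotations (x ∙ y) ≡ swapRotations x ∙ swapRotations y)
  swapRotations-not-homomorphism 3≤n hom = ⊖[1]≢[1] 3≤n (begin
    ⊖ [ 1 ]            ≡⟨ ⊕-identityˡ (⊖ [ 1 ]) ⟨
    [ 0 ] ⊕ ⊖ [ 1 ]    ≡⟨ cong (proj₂ ∘ proj₂) (hom (s , 1D) (r , 1D)) ⟩
    [ 0 ] ⊕ [ 1 ]      ≡⟨ ⊕-identityˡ [ 1 ] ⟩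
    [ 1 ]              ∎)
    where open ≡-Reasoning

  e∉connectionSet : 2 ≤ n → e ∉ connectionSet
  e∉connectionSet _   (here ())
  e∉connectionSet 2≤n (there (here e≡rr)) = [1]≢[0] 2≤n (sym (cong (proj₂ ∘ proj₁) e≡rr))
  e∉connectionSet _   (there (there (here ())))

  Reaches-e : Carrier → Set
  Reaches-e g = Star (Adj connectionSet) g e

  rotations : Fin n → Fin n → Carrier
  rotations i j = (false , i) , (false , j)

  reflectˡ : ∀ {t i x} → Reaches-e ((t , i) , x) → Reaches-e ((not t , i) , x)
  reflectˡ {t} {i} {x} =
    subst Reaches-e (cong₂ _,_ (∙-reflection t i) (D.identityʳ x)) ∘ ◅-∙ (there (there (here refl)))

  reflectʳ : ∀ {x u j} → Reaches-e (x , (u , j)) → Reaches-e (x , (not u , j))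
  reflectʳ {x} {u} {j} =
    subst Reaches-e (cong₂ _,_ (D.identityʳ x) (∙-reflection u j)) ∘ ◅-∙ (here refl)

  rotate : ∀ {i j} → Reaches-e (rotations i j) → Reaches-e (rotations (i ⊕ [ 1 ]) (j ⊕ [ 1 ]))
  rotate = ◅-∙ (there (here refl))

  -- While the first coordinate is a reflection, (r, r) rotates it by r⁻¹.
  rotate-second-twice : ∀ {i j} →
    Reaches-e (rotations i j) → Reaches-e (rotations i (j ⊕ [ 1 ] ⊕ [ 1 ]))
  rotate-second-twice {i} {j} =
    reflectˡ
    ∘ subst (λ k → Reaches-e ((true , k) , (false , j ⊕ [ 1 ] ⊕ [ 1 ]))) (//-rightDividesʳ [ 1 ] i)
    ∘ ◅-∙ (there (here refl)) ∘ reflectˡ ∘ rotate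

  diagonal : ∀ a → Reaches-e (rotations [ a ] [ a ])
  diagonal zero    = ε
  diagonal (suc a) =
    subst Reaches-e (sym (cong₂ rotations (modN-suc a) (modN-suc a))) (rotate (diagonal a))

  shift : ∀ m {i a} → Reaches-e (rotations i [ a ]) → Reaches-e (rotations i [ m * 2 + a ])
  shift zero            = id
  shift (suc m) {i} {a} = subst Reaches-e (cong (rotations i) (sym [2+b])) ∘ rotate-second-twice ∘ shift m
    where
      b = m * 2 + a
      [2+b] : [ suc (suc b) ] ≡ [ b ] ⊕ [ 1 ] ⊕ [ 1 ]
      [2+b] = trans (modN-suc (suc b)) (cong (_⊕ [ 1 ]) (modN-suc b))

  reaches-rotations : ∃ (λ k → n ≡ suc (2 * k)) → ∀ i j → Reaches-e (rotations i j)
  reaches-rotations (k , n-odd) i j =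
    subst Reaches-e (cong₂ rotations (modN-toℕ i) reaches-j) (shift m (diagonal (toℕ i)))
    where
      m : ℕ
      m = suc k * toℕ (j ⊕ ⊖ i)

      reaches-j : [ m * 2 + toℕ i ] ≡ j
      reaches-j = begin
        [ m * 2 + toℕ i ]          ≡⟨ modN-+ (m * 2) (toℕ i) ⟩
        [ m * 2 ] ⊕ [ toℕ i ]      ≡⟨ cong₂ _⊕_ (modN-halve k n-odd (toℕ (j ⊕ ⊖ i))) (modN-toℕ i) ⟩
        [ toℕ (j ⊕ ⊖ i) ] ⊕ i      ≡⟨ cong (_⊕ i) (modN-toℕ (j ⊕ ⊖ i)) ⟩
        j ⊕ ⊖ i ⊕ i                ≡⟨ //-rightDividesˡ i j ⟩
        j                          ∎
        where open ≡-Reasoning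

  reaches-e : ∃ (λ k → n ≡ suc (2 * k)) → ∀ g → Reaches-e g
  reaches-e n-odd ((false , i) , (false , j)) = reaches-rotations n-odd i j
  reaches-e n-odd ((true  , i) , (false , j)) = reflectˡ (reaches-rotations n-odd i j)
  reaches-e n-odd ((false , i) , (true  , j)) = reflectʳ (reaches-rotations n-odd i j)
  reaches-e n-odd ((true  , i) , (true  , j)) = reflectˡ (reflectʳ (reaches-rotations n-odd i j))

  nonCCA : 3 ≤ n → ∃ (λ k → n ≡ suc (2 * k)) → NonCCA
  nonCCA 3≤n n-odd =
    connectionSet , e∉connectionSet (ℕ.<⇒≤ 3≤n) , reach-e⇒connected (reaches-e n-odd) ,
    swapRotations , involution⇒isColourPreservingAut (λ _ → refl) swapRotations-edge ,
    λ affine → swapRotations-not-homomorphism 3≤n (affine∧fixes-e⇒homomorphism affine refl)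

proposition3p3 : (n : ℕ) .{{_ : NonZero n}} → 3 ≤ n → ∃ (λ k → n ≡ suc (2 * k)) →
    CayleyNotions.NonCCA (Dihedral n ×G Dihedral n)
proposition3p3 n = RotationSwap.nonCCA n
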